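{- Let $n\ge1$ and let $\pi$ be a permutation of $\mathbb{Z}_n=\{0,\dots,n-1\}$ with disjoint cycles $c_1,\dots,c_m$. Let $p=n+1$, $\varphi(i)=ip\bmod n^2$ for $i\in\mathbb{Z}_{n^2}$, and for $t,g\in\mathbb{Z}_n$ let $f(t,g)=\varphi(gn+((t-g)\bmod n))$. For each $s\in\{1,\dots,m\}$, let $\ell_s$ be the length of $c_s$ and $x_s$ its minimum element, and define words $u^{[s]},v^{[s]}$ of length $n^2$ over $\mathbb{Z}_n$ as follows: the positions $f(\pi^k(x_s),k)$, $k\in\mathbb{Z}_{\ell_s}$, are distinguished, with $u^{[s]}_{f(\pi^k(x_s),k)}=\pi^k(x_s)$ and $v^{[s]}_{f(\pi^k(x_s),k)}=\pi^{k+1}(x_s)$; writing $a_i=u^{[s]}_{\varphi(i)}$, $b_i=v^{[s]}_{\varphi(i)}$ and letting $q$ satisfy $\varphi(q)=f(x_s,0)$, for $i=q+1,\dots,n^2-1,0,1,\dots,q-1$ in this order, if $\varphi(i)$ is not distinguished set $a_i=b_{i-1}$ and $b_i=b_{i-1}$ (indices modulo $n^2$). Let $u'=I(u^{[1]},\dots,u^{[m]})$ and $v'=I(v^{[1]},\dots,v^{[m]})$. Then $u'$ and $v'$ are obtained from $u=0\,1\,\cdots\,(n-1)$ and $v=\pi(0)\,\pi(1)\,\cdots\,\pi(n-1)$, respectively, by a simultaneous insertion.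
   Context: For words $w_1,\dots,w_m\in\Sigma^N$ with $w_i=w_{i,0}\cdots w_{i,N-1}$, the columnwise interleaved word is $I(w_1,\dots,w_m)=w_{1,0}w_{2,0}\cdots w_{m,0}\,w_{1,1}\cdots w_{m,1}\,\cdots\,w_{1,N-1}\cdots w_{m,N-1}$. Given words $w_1,w_2\in\Sigma^n$ with $w_i=a_{i,0}\cdots a_{i,n-1}$, a simultaneous insertion transforms each $w_i$ into $y_0a_{i,0}y_1a_{i,1}\cdots y_{n-1}a_{i,n-1}y_n$, where the words $y_0,\dots,y_n\in\Sigma^*$ are the same for both $i$. -}

module Defs where

open import Data.Nat.Base using (ℕ; zero; suc; _+_; _*_; _∸_; _%_; NonZero; _≡ᵇ_; _≤ᵇ_)
open import Data.Nat.Properties using (m*n≢0)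
open import Data.Bool.Base using (Bool; true; false; if_then_else_)
open import Data.Fin.Base using (Fin; toℕ)
open import Data.Fin.Permutation using (Permutation′; _⟨$⟩ʳ_)
open import Data.List.Base as List using (List; []; _∷_; _++_; [_]; concat; concatMap; map; allFin; upTo)
open import Data.List.NonEmpty as List⁺ using (List⁺; _∷_; toList)
open import Data.List.Relation.Unary.All using (All)
open import Data.List.Relation.Binary.Permutation.Propositional using (_↭_)
open import Data.Maybe.Base using (Maybe; just; nothing)
open import Data.Vec.Base as Vec using (Vec; []; _∷_; lookup; tabulate)
open import Data.Product.Base using (Σ; _×_)
open import Relation.Binary.PropositionalEquality using (_≡_)

weave : ∀ {A : Set} {k : ℕ} → Vec (List A) (suc k) → Vec A k → List A
weave (y ∷ []) [] = y
weave (y ∷ ys@(_ ∷ _)) (a ∷ as) = y ++ (a ∷ weave ys as)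

SimultaneousInsertion : ∀ {A : Set} {k : ℕ} → Vec A k → Vec A k → List A → List A → Set
SimultaneousInsertion {A} {k} w₁ w₂ w₁' w₂' =
  Σ (Vec (List A) (suc k)) λ ys → (weave ys w₁ ≡ w₁') × (weave ys w₂ ≡ w₂')

interleave : ∀ {A : Set} {N : ℕ} → List (Vec A N) → List A
interleave {N = N} ws = concat (map (λ c → map (λ w → lookup w c) ws) (allFin N))

rotate : ∀ {A : Set} → List A → List A
rotate [] = []
rotate (x ∷ xs) = xs ++ [ x ]

IsCycle : ∀ {n} → Permutation′ n → List⁺ (Fin n) → Set
IsCycle π c = map (π ⟨$⟩ʳ_) (toList c) ≡ rotate (toList c)

-- c₁,…,cₘ are the disjoint cycles of π (including fixed points):
-- each is a cycle and together they contain every element exactly once.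
IsCycleDecomposition : ∀ {n} → Permutation′ n → List (List⁺ (Fin n)) → Set
IsCycleDecomposition {n} π cs = All (IsCycle π) cs × (concatMap toList cs ↭ allFin n)

minFin : ∀ {n} → Fin n → Fin n → Fin n
minFin a b = if toℕ a ≤ᵇ toℕ b then a else b

minimum⁺ : ∀ {n} → List⁺ (Fin n) → Fin n
minimum⁺ c = List⁺.foldr₁ minFin c

findFirst : (ℕ → Bool) → List ℕ → Maybe ℕ
findFirst p [] = nothing
findFirst p (d ∷ ds) = if p d then just d else findFirst p ds

module Construction (n : ℕ) .{{nz : NonZero n}} (π : Permutation′ n) where

  N : ℕ
  N = n * n

  instance
    N≢0 : NonZero N
    N≢0 = m*n≢0 n n

  p : ℕ
  p = n + 1

  φ : ℕ → ℕ
  φ i = (i * p) % N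

  f : ℕ → ℕ → ℕ
  f t g = φ (g * n + ((t + n ∸ g) % n))

  πpow : ℕ → Fin n → Fin n
  πpow zero y = y
  πpow (suc k) y = π ⟨$⟩ʳ (πpow k y)

  module _ (c : List⁺ (Fin n)) where

    ℓ : ℕ
    ℓ = List⁺.length c

    x : Fin n
    x = minimum⁺ c

    distK : ℕ → Maybe ℕ
    distK j = findFirst (λ k → f (toℕ (πpow k x)) k ≡ᵇ j) (upTo ℓ)

    q : ℕ
    q with findFirst (λ i → φ i ≡ᵇ f (toℕ x) 0) (upTo N)
    ... | just i = i
    ... | nothing = 0

    idx : ℕ → ℕ
    idx d = (q + d) % N

    -- bAt d = b_{i_d}
    bAt : ℕ → Fin n
    bAt zero = πpow 1 x          -- b_q = v_{f(x,0)} = π(x)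
    bAt (suc d) with distK (φ (idx (suc d)))
    ... | just k = πpow (suc k) x
    ... | nothing = bAt d

    stepOf : ℕ → Maybe ℕ
    stepOf j = findFirst (λ d → φ (idx d) ≡ᵇ j) (List.map suc (upTo (N ∸ 1)))

    -- value at a non-distinguished position: a_i = b_i = b_{i-1}
    fillVal : ℕ → Fin n
    fillVal j with stepOf j
    ... | just (suc d) = bAt d
    ... | _ = x                   -- unreachable (φ is a bijection of Z_{n²})

    uVal : ℕ → Fin n
    uVal j with distK j
    ... | just k = πpow k x
    ... | nothing = fillVal j

    vVal : ℕ → Fin n
    vVal j with distK j
    ... | just k = πpow (suc k) x
    ... | nothing = fillVal j

    uWord : Vec (Fin n) N
    uWord = tabulate (λ j → uVal (toℕ j))

    vWord : Vec (Fin n) N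
    vWord = tabulate (λ j → vVal (toℕ j))

{-# OPTIONS --safe #-}
-- In column j of the interleaving, the entries of u^[s] and v^[s] differ only if j is
-- distinguished for c_s, where they are π^k(x_s) and π^{k+1}(x_s); elsewhere both are
-- the same filled-in letter.  Hence u' and v' arise
-- from w and π(w) by one simultaneous insertion, w being the word of distinguished
-- u-letters in column order, and it remains to show w = 0 1 ⋯ (n-1).  For t, k < n we
-- have f(t,k) = t n + ((t - k) mod n), so the letter at a distinguished position j is
-- ⌊j / n⌋ and w is sorted.  Within one cycle, k is recovered from t and (t - k) mod n,
-- so the positions f(π^k x_s, k), k < ℓ_s, are distinct; thus w lists every cycle
-- exactly once, i.e. it is a permutation of 0 1 ⋯ (n-1).
module Submission where

open import Defs
open import Data.Nat.Base using (ℕ; zero; suc; _+_; _*_; _∸_; _≤_; _<_; NonZero; _≡ᵇ_; _≤ᵇ_)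
open import Data.Nat.Properties
open import Data.Nat.DivMod
open import Data.Nat.Divisibility using (divides)
open import Data.Nat.Tactic.RingSolver using (solve-∀)
open import Data.Bool.Base using (true; false; if_then_else_; T)
open import Data.Fin.Base as Fin using (Fin; toℕ)
open import Data.Fin.Properties as Finₚ using (toℕ<n)
open import Data.Fin.Permutation using (Permutation′; _⟨$⟩ʳ_)
open import Data.List.Base as List
  using (List; []; _∷_; _++_; [_]; concat; concatMap; map; applyUpTo; upTo; length; fromMaybe)
open import Data.List.Properties
  using (++-assoc; ++-identityʳ; ∷-injectiveˡ; ∷-injectiveʳ; length-++; length-tabulate; map-++; map-∘;
         map-cong; map-tabulate; map-applyUpTo; concatMap-cong; concatMap-map; map-concatMap; concatMap-++)
open import Data.List.NonEmpty using (List⁺; _∷_; toList)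
open import Data.List.Membership.Propositional using (_∈_)
open import Data.List.Membership.Propositional.Properties using (∈-∃++; ∈-upTo⁺; ∈-upTo⁻)
open import Data.List.Relation.Unary.Any using (here; there)
open import Data.List.Relation.Unary.All as All using (All; []; _∷_)
import Data.List.Relation.Unary.All.Properties as All
open import Data.List.Relation.Unary.AllPairs as AllPairs using (AllPairs; []; _∷_)
import Data.List.Relation.Unary.AllPairs.Properties as AllPairs
open import Data.List.Relation.Unary.Unique.Propositional using (Unique)
open import Data.List.Relation.Unary.Unique.Propositional.Properties using (upTo⁺)
open import Data.List.Relation.Unary.Sorted.TotalOrder.Properties
  using (↗↭↗⇒≋; AllPairs⇒Sorted)
open import Data.List.Relation.Binary.Pointwise using (Pointwise-≡⇒≡)
open import Data.List.Relation.Binary.Permutation.Propositional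
  using (_↭_; ↭-refl; ↭-reflexive; ↭-sym; ↭-trans; ↭-prep; ↭⇒↭ₛ;
         module PermutationReasoning)
import Data.List.Relation.Binary.Permutation.Propositional.Properties as Perm
open import Data.Maybe.Base using (Maybe; just; nothing)
open import Data.Vec.Base as Vec using (Vec; []; _∷_)
open import Data.Vec.Properties using (lookup∘tabulate; tabulate-∘)
open import Data.Product.Base using (_×_; _,_; proj₁; proj₂; map₁)
open import Data.Sum.Base using (_⊎_; inj₁; inj₂; [_,_]′)
open import Function.Base using (id; _∘_; const; _on_)
open import Relation.Nullary using (¬_; contradiction)
open import Relation.Nullary.Decidable using (proof)
open import Relation.Nullary.Reflects using (Reflects; ofʸ; ofⁿ)
open import Relation.Binary.PropositionalEquality
  using (_≡_; _≢_; refl; sym; trans; cong; cong₂; subst; subst₂; module ≡-Reasoning)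
open import Algebra.Bundles using (CommutativeMonoid)
import Algebra.Properties.CommutativeSemigroup as CommutativeSemigroupProperties

private variable
  A B C : Set

concatMap-const-[] : ∀ (xs : List A) → concatMap {B = B} (const []) xs ≡ []
concatMap-const-[] []       = refl
concatMap-const-[] (_ ∷ xs) = concatMap-const-[] xs

concatMap-concatMap : ∀ (f : B → List C) (g : A → List B) xs →
  concatMap f (concatMap g xs) ≡ concatMap (concatMap f ∘ g) xs
concatMap-concatMap f g []       = refl
concatMap-concatMap f g (x ∷ xs) =
  trans (concatMap-++ f (g x) (concatMap g xs))
        (cong (concatMap f (g x) ++_) (concatMap-concatMap f g xs))

applyUpTo-cong : ∀ {f g : ℕ → A} → (∀ i → f i ≡ g i) → ∀ m → applyUpTo f m ≡ applyUpTo g m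
applyUpTo-cong f≗g zero    = refl
applyUpTo-cong f≗g (suc m) = cong₂ _∷_ (f≗g 0) (applyUpTo-cong (f≗g ∘ suc) m)

tabulate-toℕ : ∀ m (f : ℕ → A) → List.tabulate {n = m} (f ∘ toℕ) ≡ applyUpTo f m
tabulate-toℕ zero    f = refl
tabulate-toℕ (suc m) f = cong (f 0 ∷_) (tabulate-toℕ m (f ∘ suc))

map-rotate : ∀ (f : A → B) xs → map f (rotate xs) ≡ rotate (map f xs)
map-rotate f []       = refl
map-rotate f (x ∷ xs) = map-++ f xs [ x ]

All-length≤concat : ∀ (xss : List (List A)) → All (λ xs → length xs ≤ length (concat xss)) xss
All-length≤concat []         = []
All-length≤concat (xs ∷ xss) =
  ≤-trans (m≤m+n _ _) (≤-reflexive (sym (length-++ xs))) ∷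
  All.map (λ le → ≤-trans le (≤-trans (m≤n+m _ (length xs)) (≤-reflexive (sym (length-++ xs)))))
    (All-length≤concat xss)

module _ {A B : Set} where

  open CommutativeSemigroupProperties
    (CommutativeMonoid.commutativeSemigroup (Perm.++-commutativeMonoid {A = B})) using (interchange)

  concatMap-++-↭ : ∀ (F G : A → List B) xs →
    concatMap (λ x → F x ++ G x) xs ↭ concatMap F xs ++ concatMap G xs
  concatMap-++-↭ F G []       = ↭-refl
  concatMap-++-↭ F G (x ∷ xs) =
    ↭-trans (Perm.++⁺ˡ (F x ++ G x) (concatMap-++-↭ F G xs)) (interchange (F x) (G x) _ _)

  concatMap-↭ : ∀ {F G : A → List B} {xs} →
    All (λ x → F x ↭ G x) xs → concatMap F xs ↭ concatMap G xs
  concatMap-↭ []           = ↭-refl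
  concatMap-↭ (Fx↭Gx ∷ ps) = Perm.++⁺ Fx↭Gx (concatMap-↭ ps)

concatMap-comm-↭ : ∀ (F : A → B → List C) xs ys →
  concatMap (λ x → concatMap (F x) ys) xs ↭ concatMap (λ y → concatMap (λ x → F x y) xs) ys
concatMap-comm-↭ F []       ys = ↭-reflexive (sym (concatMap-const-[] ys))
concatMap-comm-↭ F (x ∷ xs) ys =
  ↭-trans (Perm.++⁺ˡ (concatMap (F x) ys) (concatMap-comm-↭ F xs ys))
          (↭-sym (concatMap-++-↭ (F x) (λ y → concatMap (λ x → F x y) xs) ys))

-- Holds definitionally: _≟_ on ℕ is implemented by _≡ᵇ_.
≡ᵇ-reflects : ∀ m n → Reflects (m ≡ n) (m ≡ᵇ n)
≡ᵇ-reflects m n = proof (m ≟ n)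

findFirst-sound : ∀ p ds {d} → findFirst p ds ≡ just d → d ∈ ds × T (p d)
findFirst-sound p (e ∷ ds) eq with p e in pe
findFirst-sound p (e ∷ ds) refl | true  = here refl , subst T (sym pe) _
...                             | false = map₁ there (findFirst-sound p ds eq)

findFirst-none : ∀ p ds → All (λ d → ¬ T (p d)) ds → findFirst p ds ≡ nothing
findFirst-none p []       []          = refl
findFirst-none p (d ∷ ds) (¬pd ∷ ¬pds) with p d
... | true  = contradiction _ ¬pd
... | false = findFirst-none p ds ¬pds

module _ (v : ℕ) (y : A) where

  concatMap-≡ᵇ-∉ : ∀ {P} → All (v ≢_) P →
    concatMap (λ j → if v ≡ᵇ j then [ y ] else []) P ≡ []
  concatMap-≡ᵇ-∉ []                  = refl
  concatMap-≡ᵇ-∉ {j ∷ _} (v≢j ∷ v∉P) with v ≡ᵇ j | ≡ᵇ-reflects v j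
  ... | true  | ofʸ v≡j = contradiction v≡j v≢j
  ... | false | _       = concatMap-≡ᵇ-∉ v∉P

  concatMap-≡ᵇ-unique : ∀ {P} → Unique P → v ∈ P →
    concatMap (λ j → if v ≡ᵇ j then [ y ] else []) P ≡ [ y ]
  concatMap-≡ᵇ-unique (v∉P ∷ _) (here refl) with v ≡ᵇ v | ≡ᵇ-reflects v v
  ... | true  | _       = cong (y ∷_) (concatMap-≡ᵇ-∉ v∉P)
  ... | false | ofⁿ v≢v = contradiction refl v≢v
  concatMap-≡ᵇ-unique {j ∷ _} (j∉P ∷ P!) (there v∈P) with v ≡ᵇ j | ≡ᵇ-reflects v j
  ... | true  | ofʸ refl = contradiction refl (All.lookup j∉P v∈P)
  ... | false | _        = concatMap-≡ᵇ-unique P! v∈P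

concatMap-findFirst-↭ : ∀ (g : ℕ → ℕ) {P} K → Unique P →
  AllPairs (λ k k′ → g k ≢ g k′) K → All (λ k → g k ∈ P) K →
  concatMap (λ j → fromMaybe (findFirst (λ k → g k ≡ᵇ j) K)) P ↭ K
concatMap-findFirst-↭ g {P} []      _  _             _            = ↭-reflexive (concatMap-const-[] P)
concatMap-findFirst-↭ g {P} (k ∷ K) P! (gk∉gK ∷ gK!) (gk∈P ∷ gK∈P) = begin
    concatMap (fromMaybe ∘ preimage (k ∷ K)) P
  ≡⟨ concatMap-cong split P ⟩
    concatMap (λ j → hit j ++ fromMaybe (preimage K j)) P
  ↭⟨ concatMap-++-↭ hit (fromMaybe ∘ preimage K) P ⟩
    concatMap hit P ++ concatMap (fromMaybe ∘ preimage K) P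
  ≡⟨ cong (_++ concatMap (fromMaybe ∘ preimage K) P) (concatMap-≡ᵇ-unique (g k) k P! gk∈P) ⟩
    k ∷ concatMap (fromMaybe ∘ preimage K) P
  ↭⟨ ↭-prep k (concatMap-findFirst-↭ g K P! gK! gK∈P) ⟩
    k ∷ K
  ∎
  where
  open PermutationReasoning
  preimage : List ℕ → ℕ → Maybe ℕ
  preimage ks j = findFirst (λ k → g k ≡ᵇ j) ks
  hit : ℕ → List ℕ
  hit j = if g k ≡ᵇ j then [ k ] else []
  split : ∀ j → fromMaybe (preimage (k ∷ K) j) ≡ hit j ++ fromMaybe (preimage K j)
  split j with g k ≡ᵇ j | ≡ᵇ-reflects (g k) j
  ... | false | _        = refl
  ... | true  | ofʸ refl = cong (λ m → k ∷ fromMaybe m)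
    (sym (findFirst-none _ K (All.map (λ gk≢gk′ → gk≢gk′ ∘ sym ∘ ≡ᵇ⇒≡ _ _) gk∉gK)))

module _ (level : A → ℕ) where

  AllPairs-level-≡ : ∀ {v xs} → All (λ a → level a ≡ v) xs → AllPairs (_≤_ on level) xs
  AllPairs-level-≡ []           = []
  AllPairs-level-≡ (a≡v ∷ as≡v) =
    All.map (λ b≡v → ≤-reflexive (trans a≡v (sym b≡v))) as≡v ∷ AllPairs-level-≡ as≡v

  concatMap-sorted : ∀ (key : ℕ → ℕ) → (∀ {i j} → i ≤ j → key i ≤ key j) →
    ∀ (Bs : ℕ → List A) → (∀ j → All (λ a → level a ≡ key j) (Bs j)) →
    ∀ {J} → AllPairs _≤_ J → AllPairs (_≤_ on level) (concatMap Bs J)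
  concatMap-sorted key mono Bs Bs-level {J} J↗ =
    AllPairs.concat⁺ (All.map⁺ (All.universal (AllPairs-level-≡ ∘ Bs-level) J))
                     (AllPairs.map⁺ (AllPairs.map blocks-ordered J↗))
    where
    blocks-ordered : ∀ {i j} → i ≤ j → All (λ a → All (λ b → level a ≤ level b) (Bs j)) (Bs i)
    blocks-ordered {i} {j} i≤j = All.map (λ a≡ → All.map (λ b≡ →
      subst₂ _≤_ (sym a≡) (sym b≡) (mono i≤j)) (Bs-level j)) (Bs-level i)

sorted-↭⇒≡ : ∀ {m} {xs ys : List (Fin m)} →
  AllPairs Fin._≤_ xs → AllPairs Fin._≤_ ys → xs ↭ ys → xs ≡ ys
sorted-↭⇒≡ {m} xs↗ ys↗ xs↭ys = Pointwise-≡⇒≡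
  (↗↭↗⇒≋ O (AllPairs⇒Sorted O xs↗) (AllPairs⇒Sorted O ys↗) (↭⇒↭ₛ xs↭ys))
  where O = Finₚ.≤-totalOrder m

allFin-sorted : ∀ {m} → AllPairs Fin._≤_ (List.allFin m)
allFin-sorted = AllPairs.tabulate⁺-< <⇒≤

upTo-sorted : ∀ m → AllPairs _≤_ (upTo m)
upTo-sorted m = AllPairs.applyUpTo⁺₁ id m (λ i<j _ → <⇒≤ i<j)

toList-tabulate : ∀ {m} (f : Fin m → A) → Vec.toList (Vec.tabulate f) ≡ List.tabulate f
toList-tabulate {m = zero}  f = refl
toList-tabulate {m = suc m} f = cong (f Fin.zero ∷_) (toList-tabulate (f ∘ Fin.suc))

interleave-tabulate : ∀ {N} (h : B → ℕ → A) (bs : List B) →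
  interleave (map (λ b → Vec.tabulate {n = N} (h b ∘ toℕ)) bs) ≡
  concatMap (λ j → map (λ b → h b j) bs) (upTo N)
interleave-tabulate {N = N} h bs = cong concat (begin
    map (λ i → map (λ w → Vec.lookup w i) (map (λ b → Vec.tabulate (h b ∘ toℕ)) bs)) (List.allFin N)
  ≡⟨ map-cong (λ i → trans (sym (map-∘ bs)) (map-cong (λ b → lookup∘tabulate (h b ∘ toℕ) i) bs))
              (List.allFin N) ⟩
    map (column ∘ toℕ) (List.allFin N)
  ≡⟨ map-tabulate id (column ∘ toℕ) ⟩
    List.tabulate (column ∘ toℕ)
  ≡⟨ tabulate-toℕ N column ⟩
    applyUpTo column N
  ≡⟨ map-applyUpTo id column N ⟨
    map column (upTo N)
  ∎)
  where
  open ≡-Reasoning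
  column : ℕ → List _
  column j = map (λ b → h b j) bs

-- A cell is a letter common to both words (inj₁) or a marked letter a (inj₂),
-- which reads a in the upper word and σ a in the lower one.
upper : A ⊎ A → A
upper = [ id , id ]′

lower : (A → A) → A ⊎ A → A
lower σ = [ id , σ ]′

markedCell : A ⊎ A → List A
markedCell = [ const [] , [_] ]′

marked : List (A ⊎ A) → List A
marked = concatMap markedCell

weave-∷ : ∀ {k} (a : A) y ys (w : Vec A k) → weave ((a ∷ y) ∷ ys) w ≡ a ∷ weave (y ∷ ys) w
weave-∷ a y []      []      = refl
weave-∷ a y (_ ∷ _) (_ ∷ _) = refl

simultaneousInsertion-cells : ∀ (σ : A → A) {k} (w : Vec A k) cells →
  Vec.toList w ≡ marked cells →
  SimultaneousInsertion w (Vec.map σ w) (map upper cells) (map (lower σ) cells)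
simultaneousInsertion-cells σ []      []               _  = [] ∷ [] , refl , refl
simultaneousInsertion-cells σ (_ ∷ _) []               ()
simultaneousInsertion-cells σ []      (inj₂ _ ∷ _)     ()
simultaneousInsertion-cells σ w       (inj₁ a ∷ cells) w≡
  with simultaneousInsertion-cells σ w cells w≡
... | y ∷ ys , e₁ , e₂ = (a ∷ y) ∷ ys ,
  trans (weave-∷ a y ys w) (cong (a ∷_) e₁) , trans (weave-∷ a y ys (Vec.map σ w)) (cong (a ∷_) e₂)
simultaneousInsertion-cells σ (_ ∷ w) (inj₂ a ∷ cells) w≡
  with refl ← ∷-injectiveˡ w≡ | simultaneousInsertion-cells σ w cells (∷-injectiveʳ w≡)
... | y ∷ ys , e₁ , e₂ = [] ∷ y ∷ ys , cong (a ∷_) e₁ , cong (σ a ∷_) e₂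

module Digits (n : ℕ) .{{_ : NonZero n}} where

  private instance
    n*n≢0 : NonZero (n * n)
    n*n≢0 = m*n≢0 n n

  [m*n+r]<n*n : ∀ {m r} → m < n → r < n → m * n + r < n * n
  [m*n+r]<n*n {m} {r} m<n r<n = begin-strict
    m * n + r  <⟨ +-monoʳ-< (m * n) r<n ⟩
    m * n + n  ≡⟨ +-comm (m * n) n ⟩
    suc m * n  ≤⟨ *-monoˡ-≤ n m<n ⟩
    n * n      ∎
    where open ≤-Reasoning

  [m*n+r]%n≡r : ∀ m {r} → r < n → (m * n + r) % n ≡ r
  [m*n+r]%n≡r m {r} r<n = begin
    (m * n + r) % n  ≡⟨ cong (_% n) (+-comm (m * n) r) ⟩
    (r + m * n) % n  ≡⟨ [m+kn]%n≡m%n r m n ⟩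
    r % n            ≡⟨ m<n⇒m%n≡m r<n ⟩
    r                ∎
    where open ≡-Reasoning

  [m*n+r]/n≡m : ∀ m {r} → r < n → (m * n + r) / n ≡ m
  [m*n+r]/n≡m m {r} r<n = begin
    (m * n + r) / n    ≡⟨ +-distrib-/-∣ˡ r (divides m refl) ⟩
    m * n / n + r / n  ≡⟨ cong₂ _+_ (m*n/n≡m m n) (m<n⇒m/n≡0 r<n) ⟩
    m + 0              ≡⟨ +-identityʳ m ⟩
    m                  ∎
    where open ≡-Reasoning

  digits-injective : ∀ {m m′ r r′} → r < n → r′ < n →
    m * n + r ≡ m′ * n + r′ → m ≡ m′ × r ≡ r′
  digits-injective {m} {m′} r<n r′<n eq =
    trans (sym ([m*n+r]/n≡m m r<n)) (trans (cong (_/ n) eq) ([m*n+r]/n≡m m′ r′<n)) ,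
    trans (sym ([m*n+r]%n≡r m r<n)) (trans (cong (_% n) eq) ([m*n+r]%n≡r m′ r′<n))

  [k+[m∸k]%n]%n≡m%n : ∀ {k m} → k ≤ m → (k + (m ∸ k) % n) % n ≡ m % n
  [k+[m∸k]%n]%n≡m%n {k} {m} k≤m = begin
    (k + (m ∸ k) % n) % n          ≡⟨ %-distribˡ-+ k ((m ∸ k) % n) n ⟩
    (k % n + (m ∸ k) % n % n) % n  ≡⟨ cong (λ z → (k % n + z) % n) (m%n%n≡m%n (m ∸ k) n) ⟩
    (k % n + (m ∸ k) % n) % n      ≡⟨ %-distribˡ-+ k (m ∸ k) n ⟨
    (k + (m ∸ k)) % n              ≡⟨ cong (_% n) (m+[n∸m]≡n k≤m) ⟩
    m % n                          ∎
    where open ≡-Reasoning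

  [m∸[m∸k]%n]%n≡k : ∀ {k m} → k < n → k ≤ m → (m ∸ (m ∸ k) % n) % n ≡ k
  [m∸[m∸k]%n]%n≡k {k} {m} k<n k≤m = begin
    (m ∸ r) % n                ≡⟨ cong (λ z → (z ∸ r) % n) m≡r+[k+q*n] ⟩
    (r + (k + q * n) ∸ r) % n  ≡⟨ cong (_% n) (m+n∸m≡n r (k + q * n)) ⟩
    (k + q * n) % n            ≡⟨ [m+kn]%n≡m%n k q n ⟩
    k % n                      ≡⟨ m<n⇒m%n≡m k<n ⟩
    k                          ∎
    where
    open ≡-Reasoning
    r = (m ∸ k) % n
    q = (m ∸ k) / n
    m≡r+[k+q*n] : m ≡ r + (k + q * n)
    m≡r+[k+q*n] = begin
      m                ≡⟨ m∸n+n≡m k≤m ⟨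
      (m ∸ k) + k      ≡⟨ cong (_+ k) (m≡m%n+[m/n]*n (m ∸ k) n) ⟩
      (r + q * n) + k  ≡⟨ +-assoc r (q * n) k ⟩
      r + (q * n + k)  ≡⟨ cong (r +_) (+-comm (q * n) k) ⟩
      r + (k + q * n)  ∎

  [k*n+r]*[n+1]%[n*n]≡[k+r]%n*n+r : ∀ k {r} → r < n →
    ((k * n + r) * (n + 1)) % (n * n) ≡ (k + r) % n * n + r
  [k*n+r]*[n+1]%[n*n]≡[k+r]%n*n+r k {r} r<n = begin
    ((k * n + r) * (n + 1)) % (n * n)    ≡⟨ cong (_% (n * n)) (expand k r n) ⟩
    (K * n + r) % (n * n)                ≡⟨ [m*n+o]%[p*n]≡[m*n]%[p*n]+o K n r<n ⟩
    K * n % (n * n) + r                  ≡⟨ cong (_+ r) (m%n*o≡m*o%[n*o] K n n) ⟨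
    K % n * n + r                        ≡⟨ cong (λ z → z % n * n + r) (+-comm (k * n) (k + r)) ⟩
    (k + r + k * n) % n * n + r          ≡⟨ cong (λ z → z * n + r) ([m+kn]%n≡m%n (k + r) k n) ⟩
    (k + r) % n * n + r                  ∎
    where
    open ≡-Reasoning
    K = k * n + (k + r)
    expand : ∀ k r n → (k * n + r) * (n + 1) ≡ (k * n + (k + r)) * n + r
    expand = solve-∀

minFin-selective : ∀ {m} (a b : Fin m) → minFin a b ≡ a ⊎ minFin a b ≡ b
minFin-selective a b with toℕ a ≤ᵇ toℕ b
... | true  = inj₁ refl
... | false = inj₂ refl

minimum⁺-∈ : ∀ {m} (c : List⁺ (Fin m)) → minimum⁺ c ∈ toList c
minimum⁺-∈ (a ∷ as) = go a as
  where
  go : ∀ a as → minimum⁺ (a ∷ as) ∈ a ∷ as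
  go a []       = here refl
  go a (b ∷ bs) with minFin-selective a (minimum⁺ (b ∷ bs))
  ... | inj₁ e = here e
  ... | inj₂ e = there (subst (_∈ b ∷ bs) (sym e) (go b bs))

module Columns (n : ℕ) .{{_ : NonZero n}} (π : Permutation′ n) where

  open Construction n π
  open Digits n

  σ : Fin n → Fin n
  σ = π ⟨$⟩ʳ_

  f-digits : ∀ {t k} → t < n → k < n → f t k ≡ t * n + (t + n ∸ k) % n
  f-digits {t} {k} t<n k<n = begin
    f t k                ≡⟨ [k*n+r]*[n+1]%[n*n]≡[k+r]%n*n+r k (m%n<n (t + n ∸ k) n) ⟩
    (k + r) % n * n + r  ≡⟨ cong (λ z → z * n + r) ([k+[m∸k]%n]%n≡m%n (m≤n⇒m≤o+n t (<⇒≤ k<n))) ⟩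
    (t + n) % n * n + r  ≡⟨ cong (λ z → z * n + r) ([m+n]%n≡m%n t n) ⟩
    t % n * n + r        ≡⟨ cong (λ z → z * n + r) (m<n⇒m%n≡m t<n) ⟩
    t * n + r            ∎
    where
    open ≡-Reasoning
    r = (t + n ∸ k) % n

  f<N : ∀ {t k} → t < n → k < n → f t k < N
  f<N t<n k<n = subst (_< N) (sym (f-digits t<n k<n)) ([m*n+r]<n*n t<n (m%n<n _ n))

  f/n : ∀ {t k} → t < n → k < n → f t k / n ≡ t
  f/n {t} t<n k<n = trans (cong (_/ n) (f-digits t<n k<n)) ([m*n+r]/n≡m t (m%n<n _ n))

  f-injectiveʳ : ∀ {t t′ k k′} → t < n → t′ < n → k < n → k′ < n →
    f t k ≡ f t′ k′ → k ≡ k′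
  f-injectiveʳ {t} {t′} {k} {k′} t<n t′<n k<n k′<n eq = begin
    k                                    ≡⟨ [m∸[m∸k]%n]%n≡k k<n (m≤n⇒m≤o+n t (<⇒≤ k<n)) ⟨
    (t + n ∸ (t + n ∸ k) % n) % n        ≡⟨ cong₂ (λ a b → (a + n ∸ b) % n) t≡t′ r≡r′ ⟩
    (t′ + n ∸ (t′ + n ∸ k′) % n) % n     ≡⟨ [m∸[m∸k]%n]%n≡k k′<n (m≤n⇒m≤o+n t′ (<⇒≤ k′<n)) ⟩
    k′                                   ∎
    where
    open ≡-Reasoning
    digits≡ = digits-injective (m%n<n _ n) (m%n<n _ n)
      (trans (sym (f-digits t<n k<n)) (trans eq (f-digits t′<n k′<n)))
    t≡t′ = proj₁ digits≡
    r≡r′ = proj₂ digits≡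

  Cyclic : List (Fin n) → Set
  Cyclic xs = map σ xs ≡ rotate xs

  rotate-cyclic : ∀ {xs} → Cyclic xs → Cyclic (rotate xs)
  rotate-cyclic {xs} cyc = trans (map-rotate σ xs) (cong rotate cyc)

  ++-comm-cyclic : ∀ as bs → Cyclic (as ++ bs) → Cyclic (bs ++ as)
  ++-comm-cyclic []       bs cyc = subst Cyclic (sym (++-identityʳ bs)) cyc
  ++-comm-cyclic (a ∷ as) bs cyc =
    subst Cyclic (++-assoc bs [ a ] as)
      (++-comm-cyclic as (bs ++ [ a ]) (subst Cyclic (++-assoc as bs [ a ]) (rotate-cyclic cyc)))

  orbit : Fin n → ℕ → List (Fin n)
  orbit y m = applyUpTo (λ k → πpow k y) m

  πpow-σ : ∀ k y → πpow k (σ y) ≡ πpow (suc k) y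
  πpow-σ zero    y = refl
  πpow-σ (suc k) y = cong σ (πpow-σ k y)

  ∷-orbit : ∀ {y z} ys → map σ (y ∷ ys) ≡ ys ++ [ z ] → y ∷ ys ≡ orbit y (suc (length ys))
  ∷-orbit []       _  = refl
  ∷-orbit {y} (_ ∷ ys) eq with refl ← ∷-injectiveˡ eq =
    cong (y ∷_) (trans (∷-orbit ys (∷-injectiveʳ eq))
                       (applyUpTo-cong (λ k → πpow-σ k y) (suc (length ys))))

  orbit-↭ : ∀ {y xs} → Cyclic xs → y ∈ xs → orbit y (length xs) ↭ xs
  orbit-↭ {y} cyc y∈xs with as , bs , refl ← ∈-∃++ y∈xs = begin
    orbit y (length (as ++ y ∷ bs))    ≡⟨ cong (orbit y) (Perm.↭-length (Perm.++-comm as (y ∷ bs))) ⟩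
    orbit y (suc (length (bs ++ as)))  ≡⟨ ∷-orbit (bs ++ as) (++-comm-cyclic as (y ∷ bs) cyc) ⟨
    y ∷ bs ++ as                       ↭⟨ Perm.++-comm (y ∷ bs) as ⟩
    as ++ y ∷ bs                       ∎
    where open PermutationReasoning

  cycle-length≤n : ∀ {cs} → IsCycleDecomposition π cs → All (λ c → ℓ c ≤ n) cs
  cycle-length≤n {cs} (_ , cs↭) =
    All.map⁻ (All.map (λ le → ≤-trans le (≤-reflexive total)) (All-length≤concat (map toList cs)))
    where
    total : length (concatMap toList cs) ≡ n
    total = trans (Perm.↭-length cs↭) (length-tabulate id)

  position : List⁺ (Fin n) → ℕ → ℕ
  position c k = f (toℕ (πpow k (x c))) k

  cell : List⁺ (Fin n) → ℕ → Fin n ⊎ Fin n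
  cell c j with distK c j
  ... | just k  = inj₂ (πpow k (x c))
  ... | nothing = inj₁ (fillVal c j)

  cells : List (List⁺ (Fin n)) → List (Fin n ⊎ Fin n)
  cells cs = concatMap (λ j → map (λ c → cell c j) cs) (upTo N)

  uVal≡upper : ∀ c j → uVal c j ≡ upper (cell c j)
  uVal≡upper c j with distK c j
  ... | just _  = refl
  ... | nothing = refl

  vVal≡lower : ∀ c j → vVal c j ≡ lower σ (cell c j)
  vVal≡lower c j with distK c j
  ... | just _  = refl
  ... | nothing = refl

  interleave-cells : ∀ (g : Fin n ⊎ Fin n → Fin n) (W : List⁺ (Fin n) → ℕ → Fin n) →
    (∀ c j → W c j ≡ g (cell c j)) →
    ∀ cs → interleave (map (λ c → Vec.tabulate {n = N} (W c ∘ toℕ)) cs) ≡ map g (cells cs)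
  interleave-cells g W W≡ cs = begin
    interleave (map (λ c → Vec.tabulate {n = N} (W c ∘ toℕ)) cs)
      ≡⟨ interleave-tabulate {N = N} W cs ⟩
    concatMap (λ j → map (λ c → W c j) cs) (upTo N)
      ≡⟨ concatMap-cong (λ j → trans (map-cong (λ c → W≡ c j) cs) (map-∘ cs)) (upTo N) ⟩
    concatMap (λ j → map g (map (λ c → cell c j) cs)) (upTo N)
      ≡⟨ map-concatMap g _ (upTo N) ⟨
    map g (cells cs)
      ∎
    where open ≡-Reasoning

  markedCell-cell : ∀ c j →
    markedCell (cell c j) ≡ map (λ k → πpow k (x c)) (fromMaybe (distK c j))
  markedCell-cell c j with distK c j
  ... | just _  = refl
  ... | nothing = refl

  markedCell-level : ∀ c j → ℓ c ≤ n → All (λ a → toℕ a ≡ j / n) (markedCell (cell c j))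
  markedCell-level c j ℓ≤n with distK c j in eq
  ... | nothing = []
  ... | just k with k∈ , hit ← findFirst-sound (λ k → position c k ≡ᵇ j) (upTo (ℓ c)) eq =
    trans (sym (f/n (toℕ<n _) (<-≤-trans (∈-upTo⁻ k∈) ℓ≤n))) (cong (_/ n) (≡ᵇ⇒≡ _ _ hit))
    ∷ []

  marked-cells : ∀ cs →
    marked (cells cs) ≡ concatMap (λ j → concatMap (λ c → markedCell (cell c j)) cs) (upTo N)
  marked-cells cs =
    trans (concatMap-concatMap markedCell _ (upTo N))
          (concatMap-cong (λ j → concatMap-map markedCell (λ c → cell c j) cs) (upTo N))

  cycle-marked-↭ : ∀ c → IsCycle π c → ℓ c ≤ n →
    concatMap (markedCell ∘ cell c) (upTo N) ↭ toList c
  cycle-marked-↭ c cyc ℓ≤n = begin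
    concatMap (markedCell ∘ cell c) (upTo N)
      ≡⟨ concatMap-cong (markedCell-cell c) (upTo N) ⟩
    concatMap (map h ∘ fromMaybe ∘ distK c) (upTo N)
      ≡⟨ map-concatMap h (fromMaybe ∘ distK c) (upTo N) ⟨
    map h (concatMap (fromMaybe ∘ distK c) (upTo N))
      ↭⟨ Perm.map⁺ h positions↭ ⟩
    map h (upTo (ℓ c))
      ≡⟨ map-applyUpTo id h (ℓ c) ⟩
    orbit (x c) (ℓ c)
      ↭⟨ orbit-↭ cyc (minimum⁺-∈ c) ⟩
    toList c
      ∎
    where
    open PermutationReasoning
    h : ℕ → Fin n
    h k = πpow k (x c)
    <n : ∀ {k} → k < ℓ c → k < n
    <n k<ℓ = <-≤-trans k<ℓ ℓ≤n
    positions↭ : concatMap (fromMaybe ∘ distK c) (upTo N) ↭ upTo (ℓ c)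
    positions↭ = concatMap-findFirst-↭ (position c) (upTo (ℓ c)) (upTo⁺ N)
      (AllPairs.applyUpTo⁺₁ id (ℓ c) λ i<j j<ℓ →
        <⇒≢ i<j ∘ f-injectiveʳ (toℕ<n _) (toℕ<n _) (<n (<-trans i<j j<ℓ)) (<n j<ℓ))
      (All.applyUpTo⁺₁ id (ℓ c) λ k<ℓ → ∈-upTo⁺ (f<N (toℕ<n _) (<n k<ℓ)))

  marked-cells-↭ : ∀ cs → IsCycleDecomposition π cs → marked (cells cs) ↭ List.allFin n
  marked-cells-↭ cs dec@(cycles , cs↭) = begin
    marked (cells cs)
      ≡⟨ marked-cells cs ⟩
    concatMap (λ j → concatMap (λ c → markedCell (cell c j)) cs) (upTo N)
      ↭⟨ concatMap-comm-↭ (λ j c → markedCell (cell c j)) (upTo N) cs ⟩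
    concatMap (λ c → concatMap (markedCell ∘ cell c) (upTo N)) cs
      ↭⟨ concatMap-↭ (All.zipWith (λ {c} (cyc , ℓ≤n) → cycle-marked-↭ c cyc ℓ≤n)
                                  (cycles , cycle-length≤n dec)) ⟩
    concatMap toList cs
      ↭⟨ cs↭ ⟩
    List.allFin n
      ∎
    where open PermutationReasoning

  marked-cells-sorted : ∀ cs → All (λ c → ℓ c ≤ n) cs → AllPairs Fin._≤_ (marked (cells cs))
  marked-cells-sorted cs ℓ≤n = subst (AllPairs Fin._≤_) (sym (marked-cells cs))
    (concatMap-sorted toℕ (_/ n) (/-monoˡ-≤ n) _ column-level (upTo-sorted N))
    where
    column-level : ∀ j →
      All (λ a → toℕ a ≡ j / n) (concatMap (λ c → markedCell (cell c j)) cs)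
    column-level j = All.concat⁺ (All.map⁺ (All.map (λ {c} → markedCell-level c j) ℓ≤n))

  marked-cells≡allFin : ∀ cs → IsCycleDecomposition π cs → marked (cells cs) ≡ List.allFin n
  marked-cells≡allFin cs dec =
    sorted-↭⇒≡ (marked-cells-sorted cs (cycle-length≤n dec)) allFin-sorted (marked-cells-↭ cs dec)

lemma8 : (n : ℕ) .{{_ : NonZero n}} (π : Permutation′ n) (cs : List (List⁺ (Fin n)))
    → IsCycleDecomposition π cs
    → SimultaneousInsertion (Vec.tabulate id) (Vec.tabulate (π ⟨$⟩ʳ_))
        (interleave (map (Construction.uWord n π) cs))
        (interleave (map (Construction.vWord n π) cs))
lemma8 n π cs dec =
  subst₂ (SimultaneousInsertion (Vec.tabulate id) (Vec.tabulate σ)) (sym u′≡cells) (sym v′≡cells)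
    (subst (λ w → SimultaneousInsertion (Vec.tabulate id) w (map upper (cells cs)) (map (lower σ) (cells cs)))
           (sym (tabulate-∘ σ id))
           (simultaneousInsertion-cells σ (Vec.tabulate id) (cells cs) letters≡))
  where
  open Construction n π
  open Columns n π
  u′≡cells : interleave (map uWord cs) ≡ map upper (cells cs)
  u′≡cells = interleave-cells upper uVal uVal≡upper cs
  v′≡cells : interleave (map vWord cs) ≡ map (lower σ) (cells cs)
  v′≡cells = interleave-cells (lower σ) vVal vVal≡lower cs
  letters≡ : Vec.toList (Vec.tabulate id) ≡ marked (cells cs)
  letters≡ = trans (toList-tabulate id) (sym (marked-cells≡allFin cs dec))
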